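{- In the non-uniform cell probe model, for any $\tau$ with $1 \leq \tau \leq n$, any LCE data structure that uses $O(n/\tau)$ bits of space in addition to the input array (string) of size $n$ requires $\Omega(\tau)$ query time.
   Context: An LCE data structure for a string (array) $A$ of length $n$ answers queries $\mathrm{LCE}(i,j)$: the length of the longest common prefix of the suffixes of $A$ starting at positions $i$ and $j$. The input array is available to the query algorithm and is not counted in the additional space. In the non-uniform cell probe model, computation is free and query time is the number of memory cells probed; the algorithm may depend arbitrarily on $n$. -}

module Defs where

open import Data.Nat using (ℕ; zero; suc; _+_; _*_; _≤_)
open import Data.Bool using (Bool)
open import Data.Fin using (Fin; toℕ)
open import Data.Fin.Properties using () renaming (_≟_ to _≟ᶠ_)
open import Data.Vec using (Vec)
open import Data.List using (List; []; _∷_; map; drop; allFin)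
open import Relation.Nullary using (yes; no)
open import Relation.Binary.PropositionalEquality using (_≡_)

Str : ℕ → ℕ → Set
Str n σ = Fin n → Fin σ

suffix : ∀ {n σ} → Str n σ → Fin n → List (Fin σ)
suffix {n} A i = drop (toℕ i) (map A (allFin n))

lcp : ∀ {σ} → List (Fin σ) → List (Fin σ) → ℕ
lcp [] _ = zero
lcp (_ ∷ _) [] = zero
lcp (x ∷ xs) (y ∷ ys) with x ≟ᶠ y
... | yes _ = suc (lcp xs ys)
... | no _ = zero

LCE : ∀ {n σ} → Str n σ → Fin n → Fin n → ℕ
LCE A i j = lcp (suffix A i) (suffix A j)

-- Non-uniform cell-probe query algorithm = an adaptive decision tree.
-- Memory: the n cells of the input array (each holding a character of Fin σ)
-- and m additional cells of w bits each (the data structure, m * w bits).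
data DT (n σ m w : ℕ) : Set where
  leaf   : ℕ → DT n σ m w
  probeA : Fin n → (Fin σ → DT n σ m w) → DT n σ m w
  probeI : Fin m → (Vec Bool w → DT n σ m w) → DT n σ m w

run : ∀ {n σ m w} → DT n σ m w → Str n σ → (Fin m → Vec Bool w) → ℕ
run (leaf r) A I = r
run (probeA k f) A I = run (f (A k)) A I
run (probeI k f) A I = run (f (I k)) A I

probes : ∀ {n σ m w} → DT n σ m w → Str n σ → (Fin m → Vec Bool w) → ℕ
probes (leaf r) A I = zero
probes (probeA k f) A I = suc (probes (f (A k)) A I)
probes (probeI k f) A I = suc (probes (f (I k)) A I)

record LCEDS (n σ m w : ℕ) : Set where
  field
    index : Str n σ → Fin m → Vec Bool w
    query : Fin n → Fin n → DT n σ m w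
    correct : ∀ (A : Str n σ) (i j : Fin n) →
              run (query i j) A (index A) ≡ LCE A i j

QueryTime≤ : ∀ {n σ m w} → LCEDS n σ m w → ℕ → Set
QueryTime≤ {n} {σ} D T =
  ∀ (A : Str n σ) (i j : Fin n) →
    probes (LCEDS.query D i j) A (LCEDS.index D A) ≤ T

module Submission where

-- Space/time lower bound for LCE data structures (encoding argument), with
-- d = 5(c+1) and n₀ = 3.  Split the string into B blocks of length P + 1;
-- block t is all zeros except one 1 at offset o_t + 1, o_t ∈ Fin P, so that
-- LCE(t(P+1), t(P+1) + 1) = o_t.  Given the m·w stored bits, the keys
-- (o_t)_t are determined by B codes below T + 1: a decoder knowing some
-- blocks simulates the query of the first unknown block on its guess
-- (unknown blocks all zero); the code says either "the simulated answer is
-- right" or at which probe the simulation first reads a cell where guess and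
-- truth differ -- the 1 of an unknown block.  Each code reveals a block, so
-- P^B ≤ 2^(mw) (T+1)^B, false for P = 2(T+1), B = mw + 1; these blocks fit
-- into the string when 5(c+1)·T < τ.  Query time 0 is refuted directly.

open import Defs
open import Data.Nat
  using (ℕ; zero; suc; _+_; _*_; _∸_; _^_; _≤_; _<_; z≤n; s≤s; _<?_; _≤?_; _≟_; pred)
open import Data.Nat.Properties
open import Data.Nat.Solver using (module +-*-Solver)
open import Data.Bool using (Bool; true; false)
open import Data.Fin using (Fin; zero; suc; toℕ; fromℕ<; combine; remQuot)
open import Data.Fin.Properties
  using (toℕ-fromℕ<; fromℕ<-toℕ; fromℕ<-cong; toℕ<n; combine-injective; combine-remQuot; injective⇒≤)
  renaming (_≟_ to _≟ᶠ_)
open import Data.Maybe using (Maybe; just; nothing; maybe′)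
open import Data.Maybe.Properties using (just-injective)
import Data.Maybe as Maybe
open import Data.Vec using (Vec; []; _∷_; lookup; replicate; tabulate)
import Data.Vec as Vec
open import Data.Vec.Properties using (lookup-map; lookup∘tabulate; ∷-injective)
open import Data.List using (List; []; _∷_; _++_; length; drop; allFin)
import Data.List as List
open import Data.List.Properties using (map-tabulate; length-replicate)
open import Data.Product using (Σ; _×_; _,_; proj₁; proj₂)
import Data.Product as Product
open import Data.Sum using (_⊎_; inj₁; inj₂)
open import Data.Unit using (⊤; tt)
open import Data.Empty using (⊥-elim)
open import Function using (_∘_; id)
open import Relation.Nullary using (¬_; yes; no; does)
open import Relation.Nullary.Decidable using (dec-true; dec-false)
open import Relation.Binary.PropositionalEquality
open import Algebra.Properties.CommutativeSemigroup *-commutativeSemigroup using (interchange)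

Memory : ℕ → ℕ → Set
Memory m w = Fin m → Vec Bool w

module _ {n σ m w : ℕ} where

  run-≗ : ∀ (Q : DT n σ m w) A {I J : Memory m w} → I ≗ J → run Q A I ≡ run Q A J
  run-≗ (leaf r) A eq = refl
  run-≗ (probeA p f) A eq = run-≗ (f (A p)) A eq
  run-≗ (probeI q f) A {I} {J} eq rewrite eq q = run-≗ (f (J q)) A eq

  probes-≗ : ∀ (Q : DT n σ m w) A {I J : Memory m w} → I ≗ J → probes Q A I ≡ probes Q A J
  probes-≗ (leaf r) A eq = refl
  probes-≗ (probeA p f) A eq = cong suc (probes-≗ (f (A p)) A eq)
  probes-≗ (probeI q f) A {I} {J} eq rewrite eq q = cong suc (probes-≗ (f (J q)) A eq)

  arrayProbe : DT n σ m w → Str n σ → Memory m w → ℕ → Maybe (Fin n)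
  arrayProbe (leaf r) A I j = nothing
  arrayProbe (probeA p f) A I zero = just p
  arrayProbe (probeA p f) A I (suc j) = arrayProbe (f (A p)) A I j
  arrayProbe (probeI q f) A I zero = nothing
  arrayProbe (probeI q f) A I (suc j) = arrayProbe (f (I q)) A I j

  record Divergence (Q : DT n σ m w) (A A′ : Str n σ) (I : Memory m w) : Set where
    constructor divergeAt
    field
      step : ℕ
      cell : Fin n
      early : step < probes Q A I
      probed : arrayProbe Q A′ I step ≡ just cell
      differs : ¬ A cell ≡ A′ cell

  divergence : ∀ Q (A A′ : Str n σ) I → run Q A I ≡ run Q A′ I ⊎ Divergence Q A A′ I
  divergence (leaf r) A A′ I = inj₁ refl
  divergence (probeA p f) A A′ I with A p ≟ᶠ A′ p
  ... | no differ = inj₂ (divergeAt zero p (s≤s z≤n) refl differ)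
  ... | yes same with divergence (f (A p)) A A′ I
  ...   | inj₁ agree = inj₁ (trans agree (cong (λ c → run (f c) A′ I) same))
  ...   | inj₂ (divergeAt j c early probed differs) =
    inj₂ (divergeAt (suc j) c (s≤s early) (subst (λ x → arrayProbe (f x) A′ I j ≡ just c) same probed) differs)
  divergence (probeI q f) A A′ I with divergence (f (I q)) A A′ I
  ... | inj₁ agree = inj₁ agree
  ... | inj₂ (divergeAt j c early probed differs) = inj₂ (divergeAt (suc j) c (s≤s early) probed differs)

  divergenceCode : ∀ {Q A A′ I T} → run Q A I ≡ run Q A′ I ⊎ Divergence Q A A′ I →
                   probes Q A I ≤ T → Fin (suc T)
  divergenceCode (inj₁ _) _ = zero
  divergenceCode (inj₂ d) fast = suc (fromℕ< (≤-trans (Divergence.early d) fast))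

  -- A tree making no probe is a leaf: its answer ignores the input.
  probe-free-constant : ∀ (Q : DT n σ m w) A I → probes Q A I ≤ 0 →
                        ∀ A′ I′ → run Q A I ≡ run Q A′ I′
  probe-free-constant (leaf r) A I _ A′ I′ = refl

-- The suffix starting at a position given as a number; `suffix A i` is
-- `suffixAt A (toℕ i)` by definition.
suffixAt : ∀ {n σ} → Str n σ → ℕ → List (Fin σ)
suffixAt {n} A p = drop p (List.map A (allFin n))

drop-tabulate : ∀ {X : Set} {n} (f : Fin n → X) p (p<n : p < n) →
  drop p (List.tabulate f) ≡ f (fromℕ< p<n) ∷ drop (suc p) (List.tabulate f)
drop-tabulate {n = suc n} f zero p<n = refl
drop-tabulate {n = suc n} f (suc p) (s≤s p<n) = drop-tabulate (f ∘ suc) p p<n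

fromPositions : ∀ {n σ} → (ℕ → Fin σ) → Str n σ
fromPositions f i = f (toℕ i)

module _ {n σ : ℕ} (f : ℕ → Fin σ) where

  suffixAt-step : ∀ p → p < n → suffixAt (fromPositions {n} f) p ≡ f p ∷ suffixAt (fromPositions {n} f) (suc p)
  suffixAt-step p p<n = begin
      drop p (List.map (fromPositions {n} f) (allFin n))
    ≡⟨ cong (drop p) (map-tabulate id (fromPositions {n} f)) ⟩
      drop p (List.tabulate (fromPositions {n} f))
    ≡⟨ drop-tabulate (fromPositions {n} f) p p<n ⟩
      f (toℕ (fromℕ< p<n)) ∷ drop (suc p) (List.tabulate (fromPositions {n} f))
    ≡⟨ cong₂ _∷_ (cong f (toℕ-fromℕ< p<n)) (cong (drop (suc p)) (sym (map-tabulate id (fromPositions {n} f)))) ⟩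
      f p ∷ drop (suc p) (List.map (fromPositions {n} f) (allFin n))
    ∎ where open ≡-Reasoning

  suffixAt-run : ∀ c r p → (∀ x → x < r → f (p + x) ≡ c) → p + r ≤ n →
    suffixAt (fromPositions {n} f) p ≡ List.replicate r c ++ suffixAt (fromPositions {n} f) (p + r)
  suffixAt-run c zero p _ _ = cong (suffixAt (fromPositions {n} f)) (sym (+-identityʳ p))
  suffixAt-run c (suc r) p run fits = begin
      suffixAt S p
    ≡⟨ suffixAt-step p (≤-trans (s≤s (m≤m+n p r)) fits′) ⟩
      f p ∷ suffixAt S (suc p)
    ≡⟨ cong₂ _∷_ (trans (cong f (sym (+-identityʳ p))) (run 0 (s≤s z≤n)))
                 (suffixAt-run c r (suc p) (λ x x<r → trans (cong f (sym (+-suc p x))) (run (suc x) (s≤s x<r)))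
                                           fits′) ⟩
      c ∷ List.replicate r c ++ suffixAt S (suc p + r)
    ≡⟨ cong (λ q → c ∷ List.replicate r c ++ suffixAt S q) (sym (+-suc p r)) ⟩
      c ∷ List.replicate r c ++ suffixAt S (p + suc r)
    ∎ where
      open ≡-Reasoning
      S : Str n σ
      S = fromPositions f
      fits′ : suc p + r ≤ n
      fits′ = ≤-trans (≤-reflexive (sym (+-suc p r))) fits

lcp-after-prefix : ∀ {σ} (u : List (Fin σ)) {x y} xs ys → ¬ x ≡ y →
                   lcp (u ++ x ∷ xs) (u ++ y ∷ ys) ≡ length u
lcp-after-prefix [] {x} {y} xs ys x≢y with x ≟ᶠ y
... | yes x≡y = ⊥-elim (x≢y x≡y)
... | no _ = refl
lcp-after-prefix (z ∷ u) xs ys x≢y with z ≟ᶠ z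
... | yes _ = cong suc (lcp-after-prefix u xs ys x≢y)
... | no z≢z = ⊥-elim (z≢z refl)

module Blocks (n σ′ P : ℕ) where

  σ : ℕ
  σ = suc (suc σ′)

  L : ℕ
  L = suc P

  -- Knowledge of b blocks: the offset of each block, where known.
  Knowledge : ℕ → Set
  Knowledge b = Vec (Maybe (Fin P)) b

  reveal : ∀ {b} → Vec (Fin P) b → Knowledge b
  reveal = Vec.map just

  -- Inside a block of offset o, the only 1 is at position o + 1; a block of
  -- unknown offset is guessed to be all zeros.
  marker : Maybe (Fin P) → ℕ → Bool
  marker nothing x = false
  marker (just o) x = does (x ≟ suc (toℕ o))

  marker-at : ∀ o → marker (just o) (suc (toℕ o)) ≡ true
  marker-at o = dec-true (suc (toℕ o) ≟ suc (toℕ o)) refl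

  marker-off : ∀ o x → ¬ x ≡ suc (toℕ o) → marker (just o) x ≡ false
  marker-off o x = dec-false (x ≟ suc (toℕ o))

  bitsOf : ∀ {b} → Knowledge b → ℕ → Bool
  bitsOf [] p = false
  bitsOf (s ∷ st) p with p <? L
  ... | yes _ = marker s p
  ... | no _ = bitsOf st (p ∸ L)

  bitsOf-skip : ∀ {b} s (st : Knowledge b) y → bitsOf (s ∷ st) (L + y) ≡ bitsOf st y
  bitsOf-skip s st y with L + y <? L
  ... | yes L+y<L = ⊥-elim (m+n≮m L y L+y<L)
  ... | no _ = cong (bitsOf st) (m+n∸m≡n L y)

  bitsOf-block : ∀ {b} (st : Knowledge b) t x → x < L → bitsOf st (toℕ t * L + x) ≡ marker (lookup st t) x
  bitsOf-block (s ∷ st) zero x x<L with x <? L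
  ... | yes _ = refl
  ... | no x≮L = ⊥-elim (x≮L x<L)
  bitsOf-block (s ∷ st) (suc t) x x<L = begin
      bitsOf (s ∷ st) ((L + toℕ t * L) + x) ≡⟨ cong (bitsOf (s ∷ st)) (+-assoc L (toℕ t * L) x) ⟩
      bitsOf (s ∷ st) (L + (toℕ t * L + x)) ≡⟨ bitsOf-skip s st (toℕ t * L + x) ⟩
      bitsOf st (toℕ t * L + x)             ≡⟨ bitsOf-block st t x x<L ⟩
      marker (lookup st t) x                ∎
    where open ≡-Reasoning

  bit : Bool → Fin σ
  bit false = zero
  bit true = suc zero

  blockString : ∀ {b} → Knowledge b → Str n σ
  blockString st = fromPositions (bit ∘ bitsOf st)

  -- The key fact about the family: the query (t·L, t·L + 1) reads off the
  -- offset of block t, because the suffixes there are 0^o 0 1 … and 0^o 1 ….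
  LCE-block : ∀ {b} (st : Knowledge b) t o → lookup st t ≡ just o → (i j : Fin n) →
    toℕ i ≡ toℕ t * L → toℕ j ≡ suc (toℕ t * L) → toℕ t * L + L ≤ n →
    LCE (blockString st) i j ≡ toℕ o
  LCE-block st t o known i j i≡ j≡ fits = begin
      LCE S i j
    ≡⟨ cong₂ (λ p q → lcp (suffixAt S p) (suffixAt S q)) i≡ j≡ ⟩
      lcp (suffixAt S I) (suffixAt S (suc I))
    ≡⟨ cong₂ lcp left right ⟩
      lcp (zeros ++ bit false ∷ bit true ∷ rest) (zeros ++ bit true ∷ rest)
    ≡⟨ lcp-after-prefix zeros (bit true ∷ rest) rest (λ ()) ⟩
      length zeros
    ≡⟨ length-replicate (toℕ o) ⟩
      toℕ o
    ∎ where
      open ≡-Reasoning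
      S = blockString st
      f = bit ∘ bitsOf st
      I = toℕ t * L
      zeros = List.replicate (toℕ o) (bit false)
      rest = suffixAt S (suc (suc (I + toℕ o)))

      in-block : ∀ x → x < L → f (I + x) ≡ bit (marker (just o) x)
      in-block x x<L = cong bit (trans (bitsOf-block st t x x<L) (cong (λ s → marker s x) known))

      blank : ∀ x → x ≤ toℕ o → f (I + x) ≡ bit false
      blank x x≤o = trans (in-block x (s≤s (≤-trans x≤o (<⇒≤ (toℕ<n o)))))
                          (cong bit (marker-off o x (λ x≡ → 1+n≰n (subst (_≤ toℕ o) x≡ x≤o))))

      marked : f (suc (I + toℕ o)) ≡ bit true
      marked = trans (cong f (sym (+-suc I (toℕ o))))
                     (trans (in-block (suc (toℕ o)) (s≤s (toℕ<n o))) (cong bit (marker-at o)))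

      end : suc (suc (I + toℕ o)) ≤ n
      end = ≤-trans (≤-reflexive (sym (trans (+-suc I (suc (toℕ o))) (cong suc (+-suc I (toℕ o))))))
                    (≤-trans (+-monoʳ-≤ I (s≤s (toℕ<n o))) fits)

      left : suffixAt S I ≡ zeros ++ bit false ∷ bit true ∷ rest
      left = begin
          suffixAt S I
        ≡⟨ suffixAt-run f (bit false) (toℕ o) I (λ x x<o → blank x (<⇒≤ x<o))
                        (≤-trans (n≤1+n _) (≤-trans (n≤1+n _) end)) ⟩
          zeros ++ suffixAt S (I + toℕ o)
        ≡⟨ cong (zeros ++_) (suffixAt-step f (I + toℕ o) (≤-trans (n≤1+n _) end)) ⟩
          zeros ++ f (I + toℕ o) ∷ suffixAt S (suc (I + toℕ o))
        ≡⟨ cong (zeros ++_) (cong₂ _∷_ (blank (toℕ o) ≤-refl) (suffixAt-step f (suc (I + toℕ o)) end)) ⟩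
          zeros ++ bit false ∷ f (suc (I + toℕ o)) ∷ rest
        ≡⟨ cong (λ c → zeros ++ bit false ∷ c ∷ rest) marked ⟩
          zeros ++ bit false ∷ bit true ∷ rest
        ∎

      right : suffixAt S (suc I) ≡ zeros ++ bit true ∷ rest
      right = begin
          suffixAt S (suc I)
        ≡⟨ suffixAt-run f (bit false) (toℕ o) (suc I)
                        (λ x x<o → trans (cong f (sym (+-suc I x))) (blank (suc x) x<o)) (≤-trans (n≤1+n _) end) ⟩
          zeros ++ suffixAt S (suc (I + toℕ o))
        ≡⟨ cong (zeros ++_) (suffixAt-step f (suc (I + toℕ o)) end) ⟩
          zeros ++ f (suc (I + toℕ o)) ∷ rest
        ≡⟨ cong (λ c → zeros ++ c ∷ rest) marked ⟩
          zeros ++ bit true ∷ rest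
        ∎

  Consistent : ∀ {b} → Knowledge b → Vec (Fin P) b → Set
  Consistent [] [] = ⊤
  Consistent (nothing ∷ st) (_ ∷ k) = Consistent st k
  Consistent (just o ∷ st) (x ∷ k) = o ≡ x × Consistent st k

  unknowns : ∀ {b} → Knowledge b → ℕ
  unknowns [] = 0
  unknowns (nothing ∷ st) = suc (unknowns st)
  unknowns (just _ ∷ st) = unknowns st

  blank : ∀ b → Knowledge b
  blank b = replicate b nothing

  consistent-blank : ∀ {b} (k : Vec (Fin P) b) → Consistent (blank b) k
  consistent-blank [] = tt
  consistent-blank (x ∷ k) = consistent-blank k

  unknowns-blank : ∀ b → unknowns (blank b) ≡ b
  unknowns-blank zero = refl
  unknowns-blank (suc b) = cong suc (unknowns-blank b)

  consistent-complete : ∀ {b} (st : Knowledge b) k → Consistent st k → unknowns st ≡ 0 → st ≡ reveal k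
  consistent-complete [] [] _ _ = refl
  consistent-complete (just o ∷ st) (x ∷ k) (refl , cons) none = cong (just o ∷_) (consistent-complete st k cons none)

  firstUnknown : ∀ {b} → Knowledge b → Maybe (Fin b)
  firstUnknown [] = nothing
  firstUnknown (nothing ∷ st) = just zero
  firstUnknown (just _ ∷ st) = Maybe.map suc (firstUnknown st)

  firstUnknown-just : ∀ {b} (st : Knowledge b) t → firstUnknown st ≡ just t → lookup st t ≡ nothing
  firstUnknown-just (nothing ∷ st) zero refl = refl
  firstUnknown-just (just _ ∷ st) t found with firstUnknown st in found′
  firstUnknown-just (just _ ∷ st) .(suc t) refl | just t = firstUnknown-just st t found′

  firstUnknown-nothing : ∀ {b} (st : Knowledge b) → firstUnknown st ≡ nothing → unknowns st ≡ 0
  firstUnknown-nothing [] _ = refl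
  firstUnknown-nothing (just _ ∷ st) none with firstUnknown st in none′
  ... | nothing = firstUnknown-nothing st none′

  -- The offset signalled by a 1 at position x of a block (position 0 never
  -- carries the 1).
  offsetAt : Fin L → Maybe (Fin P)
  offsetAt zero = nothing
  offsetAt (suc o) = just o

  offsetAt-marker : ∀ o p (p<L : p < L) → ¬ false ≡ marker (just o) p → offsetAt (fromℕ< p<L) ≡ just o
  offsetAt-marker o p p<L set with p ≟ suc (toℕ o)
  ... | yes p≡ = cong offsetAt (trans (fromℕ<-cong p (suc (toℕ o)) p≡ p<L (s≤s (toℕ<n o)))
                                      (fromℕ<-toℕ (suc o) (s≤s (toℕ<n o))))
  ... | no p≢ = ⊥-elim (set (sym (marker-off o p p≢)))

  learn : ∀ {b} → Knowledge b → ℕ → Knowledge b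
  learn [] p = []
  learn (s ∷ st) p with p <? L
  ... | yes p<L = offsetAt (fromℕ< p<L) ∷ st
  ... | no _ = s ∷ learn st (p ∸ L)

  -- At a position where the guessed pattern differs from the true one, the
  -- guess is 0 and the truth is 1, in a block of unknown offset; learning
  -- there stays consistent and reveals that block.
  learn-progress : ∀ {b} (st : Knowledge b) k p → Consistent st k → ¬ bitsOf st p ≡ bitsOf (reveal k) p →
    Consistent (learn st p) k × unknowns (learn st p) < unknowns st
  learn-progress [] [] p _ differ = ⊥-elim (differ refl)
  learn-progress (s ∷ st) (x ∷ k) p cons differ with p <? L
  learn-progress (nothing ∷ st) (x ∷ k) p cons differ | yes p<L
    rewrite offsetAt-marker x p p<L differ = (refl , cons) , ≤-refl
  learn-progress (just o ∷ st) (x ∷ k) p (refl , cons) differ | yes _ = ⊥-elim (differ refl)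
  learn-progress (nothing ∷ st) (x ∷ k) p cons differ | no _ =
    Product.map₂ s≤s (learn-progress st k (p ∸ L) cons differ)
  learn-progress (just o ∷ st) (x ∷ k) p (o≡x , cons) differ | no _ =
    Product.map₁ (o≡x ,_) (learn-progress st k (p ∸ L) cons differ)

  unknown-marker-differs : ∀ {b} (st : Knowledge b) k t → lookup st t ≡ nothing →
    let p = toℕ t * L + suc (toℕ (lookup k t)) in ¬ bitsOf st p ≡ bitsOf (reveal k) p
  unknown-marker-differs st k t unknown same with trans (sym guessed) (trans same true-bit)
    where
      x = suc (toℕ (lookup k t))
      x<L = s≤s (toℕ<n (lookup k t))
      guessed : bitsOf st (toℕ t * L + x) ≡ false
      guessed = trans (bitsOf-block st t x x<L) (cong (λ s → marker s x) unknown)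
      true-bit : bitsOf (reveal k) (toℕ t * L + x) ≡ true
      true-bit = trans (bitsOf-block (reveal k) t x x<L)
                       (trans (cong (λ s → marker s x) (lookup-map t just k)) (marker-at (lookup k t)))
  ... | ()

map-injective : ∀ {X Y : Set} {f : X → Y} → (∀ {x y} → f x ≡ f y → x ≡ y) →
                ∀ {k} {u v : Vec X k} → Vec.map f u ≡ Vec.map f v → u ≡ v
map-injective f-inj {u = []} {[]} _ = refl
map-injective f-inj {u = x ∷ u} {y ∷ v} eq =
  cong₂ _∷_ (f-inj (proj₁ (∷-injective eq))) (map-injective f-inj (proj₂ (∷-injective eq)))

module Reconstruction (n σ′ m w T P B : ℕ) (D : LCEDS n (suc (suc σ′)) m w)
                      (fast : QueryTime≤ D T) (1≤P : 1 ≤ P) (fits : B * suc P ≤ n) where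

  open Blocks n σ′ P

  block-fits : (t : Fin B) → toℕ t * L + L ≤ n
  block-fits t = ≤-trans (≤-reflexive (+-comm (toℕ t * L) L)) (≤-trans (*-monoˡ-≤ L (toℕ<n t)) fits)

  start next : Fin B → Fin n
  start t = fromℕ< (≤-trans (≤-reflexive (sym (+-comm (toℕ t * L) 1)))
                            (≤-trans (+-monoʳ-≤ (toℕ t * L) (s≤s z≤n)) (block-fits t)))
  next t = fromℕ< (≤-trans (≤-reflexive (sym (+-comm (toℕ t * L) 2)))
                           (≤-trans (+-monoʳ-≤ (toℕ t * L) (s≤s 1≤P)) (block-fits t)))

  query : Fin B → DT n σ m w
  query t = LCEDS.query D (start t) (next t)

  -- The stored memory as a vector of words (the form that is counted), and
  -- the per-step codes.
  Stored : Set
  Stored = Vec (Vec Bool w) m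

  Code : Set
  Code = Fin (suc T)

  -- Decoder.  Working on block t with guess st, code 0 points to the 1 that
  -- the simulated answer predicts, code j + 1 to the cell read by probe j.
  target : Stored → Knowledge B → Fin B → Code → Maybe ℕ
  target M st t zero = just (toℕ t * L + suc (run (query t) (blockString st) (lookup M)))
  target M st t (suc j) = Maybe.map toℕ (arrayProbe (query t) (blockString st) (lookup M) (toℕ j))

  step : Stored → Knowledge B → Code → Knowledge B
  step M st c with firstUnknown st
  ... | nothing = st
  ... | just t = maybe′ (learn st) st (target M st t c)

  decode : ∀ {r} → Stored → Vec Code r → Knowledge B → Knowledge B
  decode M [] st = st
  decode M (c ∷ cs) st = decode M cs (step M st c)

  truth : Vec (Fin P) B → Str n σ
  truth k = blockString (reveal k)

  storedOf : Vec (Fin P) B → Stored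
  storedOf k = tabulate (LCEDS.index D (truth k))

  stored-≗ : ∀ k → lookup (storedOf k) ≗ LCEDS.index D (truth k)
  stored-≗ k = lookup∘tabulate (LCEDS.index D (truth k))

  within-time : ∀ k t → probes (query t) (truth k) (lookup (storedOf k)) ≤ T
  within-time k t = ≤-trans (≤-reflexive (probes-≗ (query t) (truth k) (stored-≗ k)))
                            (fast (truth k) (start t) (next t))

  chooseCode : Vec (Fin P) B → Knowledge B → Code
  chooseCode k st with firstUnknown st
  ... | nothing = zero
  ... | just t = divergenceCode (divergence (query t) (truth k) (blockString st) (lookup (storedOf k)))
                                (within-time k t)

  transcript : Vec (Fin P) B → (r : ℕ) → Knowledge B → Vec Code r
  transcript k zero st = []
  transcript k (suc r) st = chooseCode k st ∷ transcript k r (step (storedOf k) st (chooseCode k st))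

  encode : Vec (Fin P) B → Stored × Vec Code B
  encode k = storedOf k , transcript k B (blank B)

  answer-correct : ∀ k t → run (query t) (truth k) (lookup (storedOf k)) ≡ toℕ (lookup k t)
  answer-correct k t = begin
      run (query t) (truth k) (lookup (storedOf k))       ≡⟨ run-≗ (query t) (truth k) (stored-≗ k) ⟩
      run (query t) (truth k) (LCEDS.index D (truth k))   ≡⟨ LCEDS.correct D (truth k) (start t) (next t) ⟩
      LCE (truth k) (start t) (next t)                    ≡⟨ LCE-block (reveal k) t (lookup k t) (lookup-map t just k)
                                                               (start t) (next t) (toℕ-fromℕ< _) (toℕ-fromℕ< _) (block-fits t) ⟩
      toℕ (lookup k t)                                    ∎
    where open ≡-Reasoning

  step-progress : ∀ k st → Consistent st k →
    Consistent (step (storedOf k) st (chooseCode k st)) k ×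
    unknowns (step (storedOf k) st (chooseCode k st)) ≤ pred (unknowns st)
  step-progress k st cons with firstUnknown st in found
  ... | nothing rewrite firstUnknown-nothing st found = cons , z≤n
  ... | just t with divergence (query t) (truth k) (blockString st) (lookup (storedOf k))
  -- Agreement: the simulated answer is the offset of the unknown block t.
  ...   | inj₁ agree rewrite sym agree | answer-correct k t =
    Product.map₂ pred-mono-≤ (learn-progress st k _ cons (unknown-marker-differs st k t (firstUnknown-just st t found)))
  -- Divergence: the probed cell p is where guess and truth differ.
  ...   | inj₂ (divergeAt j p early probed differs)
    rewrite toℕ-fromℕ< (≤-trans early (within-time k t)) | probed =
    Product.map₂ pred-mono-≤ (learn-progress st k (toℕ p) cons (λ same → differs (cong bit (sym same))))

  decode-transcript : ∀ k r st → Consistent st k → unknowns st ≤ r →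
                      decode (storedOf k) (transcript k r st) st ≡ reveal k
  decode-transcript k zero st cons none = consistent-complete st k cons (n≤0⇒n≡0 none)
  decode-transcript k (suc r) st cons few with step-progress k st cons
  ... | cons′ , fewer = decode-transcript k r _ cons′ (≤-trans fewer (pred-mono-≤ few))

  encode-injective : ∀ {k k′} → encode k ≡ encode k′ → k ≡ k′
  encode-injective {k} {k′} same = map-injective just-injective (begin
      reveal k                                                 ≡⟨ decoded k ⟨
      decode (proj₁ (encode k)) (proj₂ (encode k)) (blank B)   ≡⟨ cong (λ e → decode (proj₁ e) (proj₂ e) (blank B)) same ⟩
      decode (proj₁ (encode k′)) (proj₂ (encode k′)) (blank B) ≡⟨ decoded k′ ⟩
      reveal k′                                                ∎)
    where
      open ≡-Reasoning
      decoded : ∀ key → decode (proj₁ (encode key)) (proj₂ (encode key)) (blank B) ≡ reveal key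
      decoded key = decode-transcript key B (blank B) (consistent-blank key) (≤-reflexive (unknowns-blank B))

vecIndex : ∀ {a k} → Vec (Fin a) k → Fin (a ^ k)
vecIndex [] = zero
vecIndex (x ∷ xs) = combine x (vecIndex xs)

vecIndex-injective : ∀ {a k} {u v : Vec (Fin a) k} → vecIndex u ≡ vecIndex v → u ≡ v
vecIndex-injective {u = []} {[]} _ = refl
vecIndex-injective {u = x ∷ u} {y ∷ v} same with combine-injective x (vecIndex u) y (vecIndex v) same
... | x≡y , rest = cong₂ _∷_ x≡y (vecIndex-injective rest)

vecOfIndex : ∀ {a} k → Fin (a ^ k) → Vec (Fin a) k
vecOfIndex zero _ = []
vecOfIndex {a} (suc k) i = proj₁ (remQuot {a} (a ^ k) i) ∷ vecOfIndex k (proj₂ (remQuot {a} (a ^ k) i))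

vecIndex-vecOfIndex : ∀ {a} k (i : Fin (a ^ k)) → vecIndex (vecOfIndex k i) ≡ i
vecIndex-vecOfIndex zero zero = refl
vecIndex-vecOfIndex {a} (suc k) i =
  trans (cong (combine (proj₁ (remQuot {a} (a ^ k) i))) (vecIndex-vecOfIndex k (proj₂ (remQuot {a} (a ^ k) i))))
        (combine-remQuot {a} (a ^ k) i)

boolDigit : Bool → Fin 2
boolDigit false = zero
boolDigit true = suc zero

boolDigit-injective : ∀ {x y} → boolDigit x ≡ boolDigit y → x ≡ y
boolDigit-injective {false} {false} _ = refl
boolDigit-injective {true} {true} _ = refl

wordIndex : ∀ {w} → Vec Bool w → Fin (2 ^ w)
wordIndex = vecIndex ∘ Vec.map boolDigit

memoryIndex : ∀ {m w} → Vec (Vec Bool w) m → Fin ((2 ^ w) ^ m)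
memoryIndex = vecIndex ∘ Vec.map wordIndex

memoryIndex-injective : ∀ {m w} {M N : Vec (Vec Bool w) m} → memoryIndex M ≡ memoryIndex N → M ≡ N
memoryIndex-injective =
  map-injective (map-injective boolDigit-injective ∘ vecIndex-injective) ∘ vecIndex-injective

encoding-bound : ∀ {a k c m w} (enc : Vec (Fin a) k → Vec (Vec Bool w) m × Vec (Fin c) k) →
                 (∀ {u v} → enc u ≡ enc v → u ≡ v) → a ^ k ≤ (2 ^ w) ^ m * c ^ k
encoding-bound {a} {k} {c} {m} {w} enc enc-injective =
  injective⇒≤ {f = index ∘ vecOfIndex k} λ {i} {j} same → begin
    i                           ≡⟨ vecIndex-vecOfIndex k i ⟨
    vecIndex (vecOfIndex k i)   ≡⟨ cong vecIndex (index-injective same) ⟩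
    vecIndex (vecOfIndex k j)   ≡⟨ vecIndex-vecOfIndex k j ⟩
    j                           ∎
  where
    open ≡-Reasoning
    index : Vec (Fin a) k → Fin ((2 ^ w) ^ m * c ^ k)
    index u = combine (memoryIndex (proj₁ (enc u))) (vecIndex (proj₂ (enc u)))
    index-injective : ∀ {u v} → index u ≡ index v → u ≡ v
    index-injective same with combine-injective _ _ _ _ same
    ... | same₁ , same₂ = enc-injective (cong₂ _,_ (memoryIndex-injective same₁) (vecIndex-injective same₂))

^-distrib-* : ∀ a b k → (a * b) ^ k ≡ a ^ k * b ^ k
^-distrib-* a b zero = refl
^-distrib-* a b (suc k) = trans (cong ((a * b) *_) (^-distrib-* a b k)) (interchange a b (a ^ k) (b ^ k))

too-many-keys : ∀ T m w → ¬ (2 * suc T) ^ suc (m * w) ≤ (2 ^ w) ^ m * suc T ^ suc (m * w)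
too-many-keys T m w bound = <⇒≱ fewer-bits (*-cancelʳ-≤ (2 ^ B) (2 ^ (w * m)) (suc T ^ B) {{m^n≢0 (suc T) B}} bound′)
  where
    B = suc (m * w)
    bound′ : 2 ^ B * suc T ^ B ≤ 2 ^ (w * m) * suc T ^ B
    bound′ = subst₂ _≤_ (^-distrib-* 2 (suc T) B) (cong (_* suc T ^ B) (^-*-assoc 2 w m)) bound
    fewer-bits : 2 ^ (w * m) < 2 ^ B
    fewer-bits = ^-monoʳ-< 2 (s≤s (s≤s z≤n)) (s≤s (≤-reflexive (*-comm w m)))

-- Query time 0 is impossible once n ≥ 3: a leaf gives one answer, but the
-- single-block strings with offsets 0 and 1 have LCE(0, 1) = 0 and 1.
no-probe-free-structure : ∀ {n σ′ m w} → 3 ≤ n → (D : LCEDS n (suc (suc σ′)) m w) → ¬ QueryTime≤ D 0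
no-probe-free-structure {n} {σ′} 3≤n D free = 0≢1+n (begin
    0                                         ≡⟨ answer zero ⟨
    run Q (S zero) (LCEDS.index D (S zero))   ≡⟨ probe-free-constant Q _ _ (free (S zero) i j) _ _ ⟩
    run Q (S one) (LCEDS.index D (S one))     ≡⟨ answer one ⟩
    1                                         ∎)
  where
    open ≡-Reasoning
    open Blocks n σ′ 2
    one : Fin 2
    one = suc zero
    S : Fin 2 → Str n σ
    S o = blockString (just o ∷ [])
    i j : Fin n
    i = fromℕ< (≤-trans (s≤s z≤n) 3≤n)
    j = fromℕ< (≤-trans (s≤s (s≤s z≤n)) 3≤n)
    Q = LCEDS.query D i j
    answer : ∀ o → run Q (S o) (LCEDS.index D (S o)) ≡ toℕ o
    answer o = trans (LCEDS.correct D (S o) i j)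
                     (LCE-block (just o ∷ []) zero o refl i j (toℕ-fromℕ< _) (toℕ-fromℕ< _) 3≤n)

no-fast-structure : ∀ {n σ′ m w} T → suc (m * w) * suc (2 * suc T) ≤ n →
                    (D : LCEDS n (suc (suc σ′)) m w) → ¬ QueryTime≤ D T
no-fast-structure {n} {σ′} {m} {w} T fits D fast = too-many-keys T m w (encoding-bound encode encode-injective)
  where open Reconstruction n σ′ m w T (2 * suc T) (suc (m * w)) D fast (s≤s z≤n) fits

block-length-bound : ∀ T → 1 ≤ T → suc (2 * suc T) ≤ 5 * T
block-length-bound (suc t) _ = begin
    suc (2 * suc (suc t)) ≡⟨ solve 1 (λ t → con 1 :+ con 2 :* (con 2 :+ t) := con 5 :+ con 2 :* t) refl t ⟩
    5 + 2 * t             ≤⟨ +-monoʳ-≤ 5 (*-monoˡ-≤ t {2} {5} (s≤s (s≤s z≤n))) ⟩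
    5 + 5 * t             ≡⟨ *-suc 5 t ⟨
    5 * suc t             ∎
  where
    open ≤-Reasoning
    open +-*-Solver

blocks-fit : ∀ c m w τ n T → 1 ≤ T → τ ≤ n → m * w * τ ≤ c * n → 5 * suc c * T ≤ τ →
             suc (m * w) * suc (2 * suc T) ≤ n
blocks-fit c m w τ n T 1≤T τ≤n space slow = *-cancelˡ-≤ (suc c) (begin
    suc c * (suc (m * w) * suc (2 * suc T)) ≤⟨ *-monoʳ-≤ (suc c) (*-monoʳ-≤ (suc (m * w)) (block-length-bound T 1≤T)) ⟩
    suc c * (suc (m * w) * (5 * T))         ≡⟨ solve 3 (λ c x t → (con 1 :+ c) :* ((con 1 :+ x) :* (con 5 :* t))
                                                            := (con 1 :+ x) :* ((con 5 :* (con 1 :+ c)) :* t)) refl c (m * w) T ⟩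
    suc (m * w) * (5 * suc c * T)           ≤⟨ *-monoʳ-≤ (suc (m * w)) slow ⟩
    τ + m * w * τ                           ≤⟨ +-mono-≤ τ≤n space ⟩
    suc c * n                               ∎)
  where
    open ≤-Reasoning
    open +-*-Solver

too-fast : ∀ c {n σ′ m w} τ T → 3 ≤ n → τ ≤ n → m * w * τ ≤ c * n →
           (D : LCEDS n (suc (suc σ′)) m w) → QueryTime≤ D T → ¬ 5 * suc c * T < τ
too-fast c τ zero 3≤n _ _ D fast _ = no-probe-free-structure 3≤n D fast
too-fast c {n} {m = m} {w} τ (suc t) _ τ≤n space D fast slow =
  no-fast-structure (suc t) (blocks-fit c m w τ n (suc t) (s≤s z≤n) τ≤n space (<⇒≤ slow)) D fast

-- The theorem, with d = 5(c+1) and n₀ = 3.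
lemma4 : (c : ℕ) → Σ ℕ λ d → Σ ℕ λ n₀ →
    (σ n τ m w : ℕ) → 2 ≤ σ → n₀ ≤ n → 1 ≤ τ → τ ≤ n →
    m * w * τ ≤ c * n →
    (D : LCEDS n σ m w) → (T : ℕ) → QueryTime≤ D T →
    τ ≤ d * T
lemma4 c = 5 * suc c , 3 , bound
  where
    bound : (σ n τ m w : ℕ) → 2 ≤ σ → 3 ≤ n → 1 ≤ τ → τ ≤ n → m * w * τ ≤ c * n →
            (D : LCEDS n σ m w) → (T : ℕ) → QueryTime≤ D T → τ ≤ 5 * suc c * T
    bound (suc (suc σ′)) n τ m w (s≤s (s≤s _)) 3≤n _ τ≤n space D T fast with τ ≤? 5 * suc c * T
    ... | yes τ≤dT = τ≤dT
    ... | no τ≰dT = ⊥-elim (too-fast c τ T 3≤n τ≤n space D fast (≰⇒> τ≰dT))
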